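{- For each $k \in \mathbb{N}$ there exists $\varepsilon = \varepsilon(k) > 0$ such that there are at most $2^{n^{2-\varepsilon}}$ distinct $U(k)$-free graphs on vertex set $[n]$.
   Context: For $k \in \mathbb{N}$, $U(k)$ is the bipartite graph with parts $A$, identified with the set of all subsets of $[k]$ (so $|A| = 2^k$), and $B = [k]$, in which $a \in A$ is adjacent to $b \in B$ iff $b \in a$. A graph $G$ is $U(k)$-free if there do not exist disjoint sets $A', B' \subset V(G)$ such that the bipartite graph $G[A',B']$ (the edges of $G$ between $A'$ and $B'$) is isomorphic to $U(k)$ with $A'$ corresponding to $A$ and $B'$ to $B$. Graphs on $[n]$ are labelled. -}

module Defs where

open import Data.Nat using (ℕ; _*_; _^_; _<_; _≤_)
open import Data.Bool using (Bool; true; false)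
open import Data.Fin using (Fin)
open import Data.Fin.Subset using (Subset; _∈_)
open import Data.Product using (Σ; ∃; _×_)
open import Relation.Binary.PropositionalEquality using (_≡_; _≢_)
open import Relation.Nullary using (¬_)

record Graph (n : ℕ) : Set where
  field
    adj   : Fin n → Fin n → Bool
    sym   : ∀ u v → adj u v ≡ adj v u
    irrfl : ∀ u → adj u u ≡ false
open Graph public

SameGraph : {n : ℕ} → Graph n → Graph n → Set
SameGraph G H = ∀ u v → adj G u v ≡ adj H u v

-- G contains U(k): disjoint vertex sets A' (indexed injectively by the
-- subsets of [k]) and B' (indexed injectively by [k]) such that the
-- bipartite graph G[A',B'] is U(k), with A' ↔ A and B' ↔ B.
ContainsU : {n : ℕ} → ℕ → Graph n → Set
ContainsU {n} k G =
  Σ (Subset k → Fin n) λ α →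
  Σ (Fin k → Fin n) λ β →
    (∀ a a' → α a ≡ α a' → a ≡ a') ×
    (∀ b b' → β b ≡ β b' → b ≡ b') ×
    (∀ a b → α a ≢ β b) ×
    (∀ a b → (adj G (α a) (β b) ≡ true → b ∈ a) × (b ∈ a → adj G (α a) (β b) ≡ true))

UFree : {n : ℕ} → ℕ → Graph n → Set
UFree k G = ¬ ContainsU k G

-- For a count c ≥ 0 and a positive rational ε = p / q, the real inequality
--   c ≤ 2 ^ (n ^ (2 - ε))
-- i.e. log₂ c ≤ n ^ (2 - p/q), encoded exactly over ℕ: every nonnegative
-- rational m / j with m / j < log₂ c (i.e. 2^m < c^j) satisfies
-- m / j < n ^ (2 - p/q), i.e. m^q * n^p < j^q * n^(2q).
AtMostTwoPow : (c n p q : ℕ) → Set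
AtMostTwoPow c n p q =
  ∀ (m j : ℕ) → 1 ≤ j → 2 ^ m < c ^ j → m ^ q * n ^ p < j ^ q * n ^ (2 * q)

module Submission where

-- Split [n] into nb blocks of m slots.  For a block b, the traces
-- N(u) ∩ b of the vertices u outside b form a set system on m points; if it shattered k
-- points, those points together with the vertices realising each pattern would form a copy
-- of U(k).  So by Sauer–Shelah a U(k)-free graph has at most (m + 1) ^ k outer traces per
-- block, and it is determined by: a table of these traces for each block, for each vertex
-- and block the index of its trace in that table, and each vertex's trace on its own block.
-- Counting codes gives log₂ c ≤ n² / M with M = 2 ^ r when n ≈ 2 ^ (E r), i.e. c ^ M ≤ 2 ^ (n²)
-- and n ≤ M ^ Q, which is the claimed bound (small n are handled by the trivial encoding).

open import Defs hiding (sym)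
import Algebra.Properties.CommutativeSemigroup as CommSemigroup
open import Data.Bool using (Bool; true; false; _∨_; _∧_; if_then_else_)
open import Data.Bool.Properties using () renaming (_≟_ to _≟ᵇ_)
open import Data.Empty using (⊥-elim)
open import Data.Fin as Fin using (Fin; zero; suc; toℕ; fromℕ<; inject≤; combine; remQuot)
open import Data.Fin.Properties
  using (toℕ-inject≤; toℕ-fromℕ<; toℕ-injective; remQuot-combine; combine-remQuot; toℕ<n; any?; *↔×; 2↔Bool; injective⇒≤)
open import Data.Fin.Subset using (Subset; ⁅_⁆)
open import Data.Fin.Subset.Properties using (x∈⁅x⁆; x∈⁅y⁆⇒x≡y)
open import Data.List using (List; []; _∷_; _++_; map; length)
open import Data.List.Properties using (length-++; length-map)
open import Data.List.Membership.Propositional using (_∈_)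
open import Data.List.Membership.Propositional.Properties using (∈-++⁺ˡ; ∈-++⁺ʳ; ∈-map⁺)
open import Data.List.Relation.Unary.Any using (here; there; index)
open import Data.Maybe using (Maybe; just; nothing; maybe′)
open import Data.Nat
open import Data.Nat.Properties
open import Data.Nat.Tactic.RingSolver using (solve-∀)
open import Data.Product using (Σ; ∃; _×_; _,_; proj₁; proj₂; uncurry)
open import Data.Product.Function.NonDependent.Propositional using (_×-↔_)
open import Data.Sum using (_⊎_; inj₁; inj₂)
open import Data.Unit using (⊤; tt)
open import Data.Vec using (Vec; []; _∷_; lookup; tabulate; replicate; uncons; padRight; fromList)
open import Data.Vec.Properties
  using (lookup∘tabulate; tabulate∘lookup; tabulate-cong; lookup-replicate; []=⇒lookup; lookup⇒[]=; ≡-dec)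
open import Function using (_∘_)
open import Function.Bundles using (_↔_; mk↔ₛ′; Inverse)
open import Function.Properties.Inverse using (↔-trans; ↔-refl)
open import Relation.Binary.PropositionalEquality
open import Relation.Nullary using (¬_; Dec; yes; no; does)
open import Relation.Nullary.Decidable using (¬?; _×-dec_; dec-true; toWitness)

+-<-split : ∀ {a b c d} → a + b < c + d → a < c ⊎ b < d
+-<-split {a} {b} {c} {d} a+b<c+d with a <? c
... | yes a<c = inj₁ a<c
... | no a≮c = inj₂ (≰⇒> λ d≤b → <⇒≱ a+b<c+d (+-mono-≤ (≮⇒≥ a≮c) d≤b))

solutions : ∀ m → (Vec Bool m → Bool) → List (Vec Bool m)
solutions zero    P = if P [] then [] ∷ [] else []
solutions (suc m) P =
  map (false ∷_) (solutions m (P ∘ (false ∷_))) ++ map (true ∷_) (solutions m (P ∘ (true ∷_)))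

count : ∀ m → (Vec Bool m → Bool) → ℕ
count m P = length (solutions m P)

count-suc : ∀ m P → count (suc m) P ≡ count m (P ∘ (false ∷_)) + count m (P ∘ (true ∷_))
count-suc m P = trans (length-++ (map (false ∷_) (solutions m P₀)))
                      (cong₂ _+_ (length-map (false ∷_) (solutions m P₀)) (length-map (true ∷_) (solutions m P₁)))
  where P₀ = P ∘ (false ∷_) ; P₁ = P ∘ (true ∷_)

∈-solutions : ∀ {m} P (x : Vec Bool m) → P x ≡ true → x ∈ solutions m P
∈-solutions P []          Px rewrite Px = here refl
∈-solutions P (false ∷ x) Px = ∈-++⁺ˡ (∈-map⁺ (false ∷_) (∈-solutions (P ∘ (false ∷_)) x Px))
∈-solutions P (true ∷ x)  Px = ∈-++⁺ʳ _ (∈-map⁺ (true ∷_) (∈-solutions (P ∘ (true ∷_)) x Px))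

count-pos : ∀ m P → 0 < count m P → ∃ λ (x : Vec Bool m) → P x ≡ true
count-pos zero P pos with P [] in Px
... | true = [] , Px
count-pos zero P () | false
count-pos (suc m) P pos with +-<-split {0} {0} (subst (0 <_) (count-suc m P) pos)
... | inj₁ pos₀ = let (x , Px) = count-pos m (P ∘ (false ∷_)) pos₀ in false ∷ x , Px
... | inj₂ pos₁ = let (x , Px) = count-pos m (P ∘ (true ∷_)) pos₁ in true ∷ x , Px

count-zero≤1 : ∀ P → count 0 P ≤ 1
count-zero≤1 P with P []
... | true  = ≤-refl
... | false = z≤n

count-modular : ∀ m (P Q : Vec Bool m → Bool) →
  count m P + count m Q ≡ count m (λ x → P x ∨ Q x) + count m (λ x → P x ∧ Q x)
count-modular zero P Q with P [] | Q []
... | true  | true  = refl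
... | true  | false = refl
... | false | true  = refl
... | false | false = refl
count-modular (suc m) P Q = begin
  count (suc m) P + count (suc m) Q
    ≡⟨ cong₂ _+_ (count-suc m P) (count-suc m Q) ⟩
  (count m P₀ + count m P₁) + (count m Q₀ + count m Q₁)
    ≡⟨ interchange (count m P₀) (count m P₁) (count m Q₀) (count m Q₁) ⟩
  (count m P₀ + count m Q₀) + (count m P₁ + count m Q₁)
    ≡⟨ cong₂ _+_ (count-modular m P₀ Q₀) (count-modular m P₁ Q₁) ⟩
  (count m ∨₀ + count m ∧₀) + (count m ∨₁ + count m ∧₁)
    ≡⟨ interchange (count m ∨₀) (count m ∧₀) (count m ∨₁) (count m ∧₁) ⟩
  (count m ∨₀ + count m ∨₁) + (count m ∧₀ + count m ∧₁)
    ≡⟨ sym (cong₂ _+_ (count-suc m (λ x → P x ∨ Q x)) (count-suc m (λ x → P x ∧ Q x))) ⟩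
  count (suc m) (λ x → P x ∨ Q x) + count (suc m) (λ x → P x ∧ Q x) ∎
  where
  open ≡-Reasoning
  P₀ = P ∘ (false ∷_) ; P₁ = P ∘ (true ∷_) ; Q₀ = Q ∘ (false ∷_) ; Q₁ = Q ∘ (true ∷_)
  ∨₀ = λ x → P₀ x ∨ Q₀ x ; ∨₁ = λ x → P₁ x ∨ Q₁ x
  ∧₀ = λ x → P₀ x ∧ Q₀ x ; ∧₁ = λ x → P₁ x ∧ Q₁ x
  open CommSemigroup +-commutativeSemigroup using (interchange)

-- Σ_{i<k} C(m,i): the Sauer–Shelah bound on the number of points of a set system
-- on m points that shatters no k coordinates.
sauerBound : ℕ → ℕ → ℕ
sauerBound m       zero    = 0
sauerBound zero    (suc k) = 1
sauerBound (suc m) (suc k) = sauerBound m (suc k) + sauerBound m k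

sauerBound≤ : ∀ m k → sauerBound m k ≤ suc m ^ k
sauerBound≤ m       zero    = z≤n
sauerBound≤ zero    (suc k) = ≤-reflexive (sym (^-zeroˡ (suc k)))
sauerBound≤ (suc m) (suc k) = begin
  sauerBound m (suc k) + sauerBound m k ≤⟨ +-mono-≤ (sauerBound≤ m (suc k)) (sauerBound≤ m k) ⟩
  suc m * suc m ^ k + suc m ^ k         ≡⟨ +-comm (suc m * suc m ^ k) _ ⟩
  suc (suc m) * suc m ^ k               ≤⟨ *-monoʳ-≤ (suc (suc m)) (^-monoˡ-≤ k (n≤1+n (suc m))) ⟩
  suc (suc m) * suc (suc m) ^ k         ∎
  where open ≤-Reasoning

Shatters : ∀ {m k} → (Vec Bool m → Bool) → (Fin k → Fin m) → Set
Shatters {m} {k} P σ =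
  ∀ (T : Vec Bool k) → Σ (Vec Bool m) λ x → P x ≡ true × (∀ i → lookup x (σ i) ≡ lookup T i)

-- If one of the halves P ∘ (false ∷_), P ∘ (true ∷_) realises a pattern, so does P; if both do,
-- P realises it with either value of the first coordinate.  Hence what the union of the halves
-- shatters, P shatters after shifting, and what their intersection shatters, P shatters together
-- with the first coordinate.
module _ {m} (P : Vec Bool (suc m) → Bool) where
  private
    P₀ = P ∘ (false ∷_)
    P₁ = P ∘ (true ∷_)

  shatters-∨ : ∀ {k} {σ : Fin k → Fin m} → Shatters (λ x → P₀ x ∨ P₁ x) σ → Shatters P (suc ∘ σ)
  shatters-∨ sh T with sh T
  ... | x , P∨x , agree with P₀ x in P₀x
  ...   | true  = false ∷ x , P₀x , agree
  ...   | false = true ∷ x , P∨x , agree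

  extend : ∀ {k} → (Fin k → Fin m) → Fin (suc k) → Fin (suc m)
  extend σ zero    = zero
  extend σ (suc i) = suc (σ i)

  shatters-∧ : ∀ {k} {σ : Fin k → Fin m} → Shatters (λ x → P₀ x ∧ P₁ x) σ → Shatters P (extend σ)
  shatters-∧ sh (t ∷ T) with sh T
  ... | x , P∧x , agree = t ∷ x , realise t P∧x , λ { zero → refl ; (suc i) → agree i }
    where
    realise : ∀ t → P₀ x ∧ P₁ x ≡ true → P (t ∷ x) ≡ true
    realise t both with P₀ x in P₀x | P₁ x in P₁x
    realise false refl | true | true = P₀x
    realise true  refl | true | true = P₁x

sauer-shelah : ∀ m k (P : Vec Bool m → Bool) → sauerBound m k < count m P →
  Σ (Fin k → Fin m) λ σ → Shatters P σ
sauer-shelah m zero P many with count-pos m P many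
... | x , Px = (λ ()) , λ { [] → x , Px , λ () }
sauer-shelah zero (suc k) P many = ⊥-elim (<⇒≱ many (count-zero≤1 P))
sauer-shelah (suc m) (suc k) P many
  with +-<-split (subst (_ <_) (trans (count-suc m P) (count-modular m _ _)) many)
... | inj₁ many∨ = let (σ , sh) = sauer-shelah m (suc k) _ many∨ in suc ∘ σ , shatters-∨ P sh
... | inj₂ many∧ = let (σ , sh) = sauer-shelah m k _ many∧ in extend P σ , shatters-∧ P sh

vec↔ : ∀ {a} {A : Set} n → Fin a ↔ A → Fin (a ^ n) ↔ Vec A n
vec↔ zero    _   = mk↔ₛ′ (λ _ → []) (λ _ → zero) (λ { [] → refl }) (λ { zero → refl })
vec↔ (suc n) a↔A = ↔-trans *↔× (↔-trans (a↔A ×-↔ vec↔ n a↔A) cons↔)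
  where
  cons↔ : ∀ {A : Set} {n} → (A × Vec A n) ↔ Vec A (suc n)
  cons↔ = mk↔ₛ′ (λ (x , xs) → x ∷ xs) uncons (λ { (x ∷ xs) → refl }) (λ _ → refl)

Distinct : ∀ {n c} → (Fin c → Graph n) → Set
Distinct G = ∀ i i' → SameGraph (G i) (G i') → i ≡ i'

distinct≤codes : ∀ {n c N} {Code : Set} → Fin N ↔ Code → (decode : Code → Fin n → Fin n → Bool) →
  (G : Fin c → Graph n) → (∀ i → Σ Code λ x → ∀ u v → decode x u v ≡ adj (G i) u v) →
  Distinct G → c ≤ N
distinct≤codes {c = c} {Code = Code} N↔Code decode G encode distinct =
  injective⇒≤ {f = λ i → from (code i)} λ {i} {i'} same →
    distinct i i' λ u v → begin
      adj (G i) u v            ≡⟨ sym (proj₂ (encode i) u v) ⟩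
      decode (code i) u v      ≡⟨ cong (λ x → decode x u v) (code-injective same) ⟩
      decode (code i') u v     ≡⟨ proj₂ (encode i') u v ⟩
      adj (G i') u v           ∎
  where
  open ≡-Reasoning
  open Inverse N↔Code using (to; from; strictlyInverseˡ)
  code : Fin c → Code
  code i = proj₁ (encode i)
  code-injective : ∀ {i i'} → from (code i) ≡ from (code i') → code i ≡ code i'
  code-injective {i} {i'} eq = trans (sym (strictlyInverseˡ (code i))) (trans (cong to eq) (strictlyInverseˡ (code i')))

-- The upper triangle of an adjacency matrix: the row of vertex 0 towards the later
-- vertices, followed by the triangle of the remaining ones.
Triangle : ℕ → Set
Triangle zero    = ⊤
Triangle (suc n) = Vec Bool n × Triangle n

-- the number of triangles, 2 ^ (n (n - 1) / 2)
triangleCount : ℕ → ℕ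
triangleCount zero    = 1
triangleCount (suc n) = 2 ^ n * triangleCount n

triangle↔ : ∀ n → Fin (triangleCount n) ↔ Triangle n
triangle↔ zero    = mk↔ₛ′ (λ _ → tt) (λ _ → zero) (λ _ → refl) (λ { zero → refl })
triangle↔ (suc n) = ↔-trans *↔× (vec↔ n 2↔Bool ×-↔ triangle↔ n)

fromTriangle : ∀ {n} → Triangle n → Fin n → Fin n → Bool
fromTriangle (row , rest) zero    zero    = false
fromTriangle (row , rest) zero    (suc v) = lookup row v
fromTriangle (row , rest) (suc u) zero    = lookup row u
fromTriangle (row , rest) (suc u) (suc v) = fromTriangle rest u v

dropFirst : ∀ {n} → Graph (suc n) → Graph n
dropFirst G = record
  { adj   = λ u v → adj G (suc u) (suc v)
  ; sym   = λ u v → Graph.sym G (suc u) (suc v)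
  ; irrfl = λ u → irrfl G (suc u)
  }

toTriangle : ∀ {n} (G : Graph n) → Σ (Triangle n) λ t → ∀ u v → fromTriangle t u v ≡ adj G u v
toTriangle {zero}  G = tt , λ ()
toTriangle {suc n} G = (row , proj₁ rest) , correct
  where
  row : Vec Bool n
  row = tabulate (λ v → adj G zero (suc v))
  rest : Σ (Triangle n) λ t → ∀ u v → fromTriangle t u v ≡ adj (dropFirst G) u v
  rest = toTriangle (dropFirst G)
  correct : ∀ u v → fromTriangle (row , proj₁ rest) u v ≡ adj G u v
  correct zero    zero    = sym (irrfl G zero)
  correct zero    (suc v) = lookup∘tabulate _ v
  correct (suc u) zero    = trans (lookup∘tabulate _ u) (Graph.sym G zero (suc u))
  correct (suc u) (suc v) = proj₂ rest u v

triangleCount² : ∀ n → triangleCount n * triangleCount n ≤ 2 ^ (n * n)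
triangleCount² zero    = ≤-refl
triangleCount² (suc n) = begin
  (2 ^ n * t) * (2 ^ n * t)   ≡⟨ interchange (2 ^ n) t (2 ^ n) t ⟩
  2 ^ n * 2 ^ n * (t * t)     ≤⟨ *-monoʳ-≤ (2 ^ n * 2 ^ n) (triangleCount² n) ⟩
  2 ^ n * 2 ^ n * 2 ^ (n * n) ≡⟨ sym (trans (^-distribˡ-+-* 2 (n + n) (n * n)) (cong (_* 2 ^ (n * n)) (^-distribˡ-+-* 2 n n))) ⟩
  2 ^ (n + n + n * n)         ≤⟨ ^-monoʳ-≤ 2 (≤-trans (n≤1+n _) (≤-reflexive (square-suc n))) ⟩
  2 ^ (suc n * suc n)         ∎
  where
  open ≤-Reasoning
  open CommSemigroup *-commutativeSemigroup using (interchange)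
  square-suc : ∀ n → suc (n + n + n * n) ≡ suc n * suc n
  square-suc = solve-∀
  t : ℕ
  t = triangleCount n

does-true⇒ : ∀ {P : Set} (d : Dec P) → does d ≡ true → P
does-true⇒ (yes p) _ = p

lookup-ext : ∀ {A : Set} {k} (xs ys : Vec A k) → (∀ i → lookup xs i ≡ lookup ys i) → xs ≡ ys
lookup-ext xs ys eq = trans (sym (tabulate∘lookup xs)) (trans (tabulate-cong eq) (tabulate∘lookup ys))

pad : ∀ {A : Set} {F} (xs : List A) → length xs ≤ F → A → Vec A F
pad xs len≤F d = padRight len≤F d (fromList xs)

lookup-pad : ∀ {A : Set} {F} {x : A} {xs} (x∈xs : x ∈ xs) (len≤F : length xs ≤ F) d →
  lookup (pad xs len≤F d) (inject≤ (index x∈xs) len≤F) ≡ x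
lookup-pad (here refl) (s≤s _)   d = refl
lookup-pad (there x∈)  (s≤s len) d = lookup-pad x∈ len d

codeCount : (n nb m F : ℕ) → ℕ
codeCount n nb m F = ((2 ^ m) ^ F) ^ nb * (((F ^ nb) ^ n) * (2 ^ m) ^ n)

-- The vertices [n] are laid out in nb blocks of m slots each; slot p of block b holds vertex
-- combine b p when that number is below n, and is empty otherwise.
module Blocks {n nb m : ℕ} (n≤nb*m : n ≤ nb * m) where

  block : Fin n → Fin nb
  block v = proj₁ (remQuot {nb} m (inject≤ v n≤nb*m))

  offset : Fin n → Fin m
  offset v = proj₂ (remQuot {nb} m (inject≤ v n≤nb*m))

  occupant : Fin nb → Fin m → Maybe (Fin n)
  occupant b p with toℕ (combine b p) <? n
  ... | yes lt = just (fromℕ< lt)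
  ... | no  _  = nothing

  slot-toℕ : ∀ v → toℕ (combine (block v) (offset v)) ≡ toℕ v
  slot-toℕ v = trans (cong toℕ (combine-remQuot {nb} m (inject≤ v n≤nb*m))) (toℕ-inject≤ v n≤nb*m)

  occupant-slot : ∀ v → occupant (block v) (offset v) ≡ just v
  occupant-slot v with toℕ (combine (block v) (offset v)) <? n
  ... | yes lt = cong just (toℕ-injective (trans (toℕ-fromℕ< lt) (slot-toℕ v)))
  ... | no ¬lt = ⊥-elim (¬lt (subst (_< n) (sym (slot-toℕ v)) (toℕ<n v)))

  occupant-block : ∀ b p v → occupant b p ≡ just v → block v ≡ b
  occupant-block b p v occ with toℕ (combine b p) <? n
  occupant-block b p v refl | yes lt =
    cong proj₁ (trans (cong (remQuot {nb} m) inject≡combine) (remQuot-combine b p))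
    where
    inject≡combine : inject≤ (fromℕ< lt) n≤nb*m ≡ combine b p
    inject≡combine = toℕ-injective (trans (toℕ-inject≤ (fromℕ< lt) n≤nb*m) (toℕ-fromℕ< lt))

  module _ (G : Graph n) where

    -- adjacency of u towards slot p of block b; empty slots count as non-adjacent
    adjSlot : Fin n → Fin nb → Fin m → Bool
    adjSlot u b p = maybe′ (adj G u) false (occupant b p)

    adjSlot-occupied : ∀ u b p v → occupant b p ≡ just v → adjSlot u b p ≡ adj G u v
    adjSlot-occupied u b p v occ rewrite occ = refl

    adjSlot-true⇒occupied : ∀ u b p → adjSlot u b p ≡ true → Σ (Fin n) λ v → occupant b p ≡ just v
    adjSlot-true⇒occupied u b p _ with occupant b p
    ... | just v = v , refl

    adjSlot-vertex : ∀ u v → adjSlot u (block v) (offset v) ≡ adj G u v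
    adjSlot-vertex u v = adjSlot-occupied u (block v) (offset v) v (occupant-slot v)

    trace : Fin n → Fin nb → Vec Bool m
    trace u b = tabulate (adjSlot u b)

    outer? : ∀ b x → Dec (∃ λ u → ¬ block u ≡ b × trace u b ≡ x)
    outer? b x = any? λ u → ¬? (block u Fin.≟ b) ×-dec ≡-dec _≟ᵇ_ (trace u b) x

    outerTraces : Fin nb → Vec Bool m → Bool
    outerTraces b x = does (outer? b x)

    -- A set σ of k offsets shattered by the outer traces of block b yields a copy of U(k):
    -- B' is the vertices in the slots σ, A' the outside vertices realising each pattern.
    shattered⇒U : ∀ {k} b (σ : Fin k → Fin m) → Shatters (outerTraces b) σ → ContainsU k G
    shattered⇒U {k} b σ sh =
      α , β , α-injective , β-injective , disjoint ,
      λ T i → (λ e → lookup⇒[]= i T (trans (sym (adj-αβ T i)) e)) , λ i∈T → trans (adj-αβ T i) ([]=⇒lookup i∈T)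
      where
      realiser : ∀ T → ∃ λ u → ¬ block u ≡ b × trace u b ≡ proj₁ (sh T)
      realiser T = does-true⇒ (outer? b _) (proj₁ (proj₂ (sh T)))

      α : Subset k → Fin n
      α T = proj₁ (realiser T)

      α-pattern : ∀ T i → adjSlot (α T) b (σ i) ≡ lookup T i
      α-pattern T i = begin
        adjSlot (α T) b (σ i)          ≡⟨ sym (lookup∘tabulate _ (σ i)) ⟩
        lookup (trace (α T) b) (σ i)   ≡⟨ cong (λ x → lookup x (σ i)) (proj₂ (proj₂ (realiser T))) ⟩
        lookup (proj₁ (sh T)) (σ i)    ≡⟨ proj₂ (proj₂ (sh T)) i ⟩
        lookup T i                     ∎
        where open ≡-Reasoning

      -- the all-true pattern shows every slot σ i is occupied
      occupied : ∀ i → Σ (Fin n) λ v → occupant b (σ i) ≡ just v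
      occupied i = adjSlot-true⇒occupied _ b (σ i) (trans (α-pattern all i) (lookup-replicate i true))
        where all = replicate k true

      β : Fin k → Fin n
      β i = proj₁ (occupied i)

      adj-αβ : ∀ T i → adj G (α T) (β i) ≡ lookup T i
      adj-αβ T i = trans (sym (adjSlot-occupied _ b (σ i) (β i) (proj₂ (occupied i)))) (α-pattern T i)

      α-injective : ∀ T T' → α T ≡ α T' → T ≡ T'
      α-injective T T' eq = lookup-ext T T' λ i →
        trans (sym (adj-αβ T i)) (trans (cong (λ u → adj G u (β i)) eq) (adj-αβ T' i))

      -- the singleton pattern ⁅ i ⁆ separates β i from every other β j
      β-injective : ∀ i j → β i ≡ β j → i ≡ j
      β-injective i j eq = sym (x∈⁅y⁆⇒x≡y i (lookup⇒[]= j ⁅ i ⁆ j∈))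
        where
        j∈ : lookup ⁅ i ⁆ j ≡ true
        j∈ = begin
          lookup ⁅ i ⁆ j       ≡⟨ sym (adj-αβ ⁅ i ⁆ j) ⟩
          adj G (α ⁅ i ⁆) (β j) ≡⟨ cong (adj G (α ⁅ i ⁆)) (sym eq) ⟩
          adj G (α ⁅ i ⁆) (β i) ≡⟨ adj-αβ ⁅ i ⁆ i ⟩
          lookup ⁅ i ⁆ i       ≡⟨ []=⇒lookup (x∈⁅x⁆ i) ⟩
          true                 ∎
          where open ≡-Reasoning

      disjoint : ∀ T i → ¬ α T ≡ β i
      disjoint T i eq = proj₁ (proj₂ (realiser T))
        (trans (cong block eq) (occupant-block b (σ i) (β i) (proj₂ (occupied i))))

    outerTraces-few : ∀ {k} → UFree k G → ∀ b → count m (outerTraces b) ≤ sauerBound m k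
    outerTraces-few {k} free b =
      ≮⇒≥ λ many → free (uncurry (shattered⇒U b) (sauer-shelah m k (outerTraces b) many))

  -- A code for a graph: for each block a table of F traces, for each vertex and block an
  -- index into that block's table, and for each vertex its trace on its own block.
  Code : ℕ → Set
  Code F = Vec (Vec (Vec Bool m) F) nb × Vec (Vec (Fin F) nb) n × Vec (Vec Bool m) n

  code↔ : ∀ F → Fin (codeCount n nb m F) ↔ Code F
  code↔ F =
    ↔-trans *↔× (vec↔ nb (vec↔ F traces↔) ×-↔
                 ↔-trans *↔× (vec↔ n (vec↔ nb ↔-refl) ×-↔ vec↔ n traces↔))
    where traces↔ = vec↔ m 2↔Bool

  decode : ∀ {F} → Code F → Fin n → Fin n → Bool
  decode (tables , indices , own) u v =
    if does (block u Fin.≟ block v)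
    then lookup (lookup own u) (offset v)
    else lookup (lookup (lookup tables (block v)) (lookup (lookup indices u) (block v))) (offset v)

  decode-correct : ∀ {F} (G : Graph n) (tables : Vec (Vec (Vec Bool m) F) nb) indices own →
    (∀ u → lookup own u ≡ trace G u (block u)) →
    (∀ u b → ¬ block u ≡ b → lookup (lookup tables b) (lookup (lookup indices u) b) ≡ trace G u b) →
    ∀ u v → decode (tables , indices , own) u v ≡ adj G u v
  decode-correct G tables indices own own-ok table-ok u v with block u Fin.≟ block v
  ... | yes same = begin
    lookup (lookup own u) (offset v)     ≡⟨ cong (λ t → lookup t (offset v)) (own-ok u) ⟩
    lookup (trace G u (block u)) (offset v) ≡⟨ lookup∘tabulate _ (offset v) ⟩
    adjSlot G u (block u) (offset v)     ≡⟨ cong (λ b → adjSlot G u b (offset v)) same ⟩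
    adjSlot G u (block v) (offset v)     ≡⟨ adjSlot-vertex G u v ⟩
    adj G u v                            ∎
    where open ≡-Reasoning
  ... | no differ = begin
    lookup (lookup (lookup tables (block v)) (lookup (lookup indices u) (block v))) (offset v)
      ≡⟨ cong (λ t → lookup t (offset v)) (table-ok u (block v) differ) ⟩
    lookup (trace G u (block v)) (offset v) ≡⟨ lookup∘tabulate _ (offset v) ⟩
    adjSlot G u (block v) (offset v)     ≡⟨ adjSlot-vertex G u v ⟩
    adj G u v                            ∎
    where open ≡-Reasoning

  encode : ∀ {k F} → sauerBound m k ≤ F → 0 < F → (G : Graph n) → UFree k G →
    Σ (Code F) λ x → ∀ u v → decode x u v ≡ adj G u v
  encode {k} {F} sauer≤F 0<F G free =
    (tables , indices , own) , decode-correct G tables indices own own-ok table-ok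
    where
    outer : Fin nb → List (Vec Bool m)
    outer b = solutions m (outerTraces G b)

    fits : ∀ b → length (outer b) ≤ F
    fits b = ≤-trans (outerTraces-few G free b) sauer≤F

    outer∈ : ∀ {u b} → ¬ block u ≡ b → trace G u b ∈ outer b
    outer∈ {u} {b} u∉b = ∈-solutions (outerTraces G b) (trace G u b) (dec-true (outer? G b _) (u , u∉b , refl))

    table : Fin nb → Vec (Vec Bool m) F
    table b = pad (outer b) (fits b) (replicate m false)

    -- the position of u's trace in the table of a block not containing u (arbitrary otherwise)
    index-of : ∀ u b → Dec (block u ≡ b) → Fin F
    index-of u b (yes _)   = fromℕ< 0<F
    index-of u b (no u∉b) = inject≤ (index (outer∈ u∉b)) (fits b)

    index-of-correct : ∀ u b (d : Dec (block u ≡ b)) → ¬ block u ≡ b → lookup (table b) (index-of u b d) ≡ trace G u b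
    index-of-correct u b (yes u∈b) u∉b  = ⊥-elim (u∉b u∈b)
    index-of-correct u b (no u∉b)  _    = lookup-pad (outer∈ u∉b) (fits b) (replicate m false)

    tables : Vec (Vec (Vec Bool m) F) nb
    tables = tabulate table

    entry : Fin n → Fin nb → Fin F
    entry u b = index-of u b (block u Fin.≟ b)

    row : Fin n → Vec (Fin F) nb
    row u = tabulate (entry u)

    indices : Vec (Vec (Fin F) nb) n
    indices = tabulate row

    own : Vec (Vec Bool m) n
    own = tabulate λ u → trace G u (block u)

    own-ok : ∀ u → lookup own u ≡ trace G u (block u)
    own-ok u = lookup∘tabulate _ u

    table-ok : ∀ u b → ¬ block u ≡ b → lookup (lookup tables b) (lookup (lookup indices u) b) ≡ trace G u b
    table-ok u b u∉b = begin
      lookup (lookup tables b) (lookup (lookup indices u) b)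
        ≡⟨ cong₂ lookup (lookup∘tabulate table b) index-at ⟩
      lookup (table b) (index-of u b (block u Fin.≟ b))
        ≡⟨ index-of-correct u b (block u Fin.≟ b) u∉b ⟩
      trace G u b ∎
      where
      open ≡-Reasoning
      index-at : lookup (lookup indices u) b ≡ index-of u b (block u Fin.≟ b)
      index-at = trans (cong (λ r → lookup r b) (lookup∘tabulate row u)) (lookup∘tabulate (entry u) b)

  distinct-free≤codeCount : ∀ {k c F} → sauerBound m k ≤ F → 0 < F → (G : Fin c → Graph n) →
    (∀ i → UFree k (G i)) → Distinct G → c ≤ codeCount n nb m F
  distinct-free≤codeCount {F = F} sauer≤F 0<F G free =
    distinct≤codes (code↔ F) decode G λ i → encode sauer≤F 0<F (G i) (free i)

^-distribʳ-* : ∀ a b q → (a * b) ^ q ≡ a ^ q * b ^ q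
^-distribʳ-* a b zero    = refl
^-distribʳ-* a b (suc q) = begin
  a * b * (a * b) ^ q       ≡⟨ cong (a * b *_) (^-distribʳ-* a b q) ⟩
  a * b * (a ^ q * b ^ q)   ≡⟨ interchange a b (a ^ q) (b ^ q) ⟩
  a * a ^ q * (b * b ^ q)   ∎
  where
  open ≡-Reasoning
  interchange : ∀ a b x y → a * b * (x * y) ≡ a * x * (b * y)
  interchange = solve-∀

pow2-+ : ∀ a b → 2 ^ a * 2 ^ b ≡ 2 ^ (a + b)
pow2-+ a b = sym (^-distribˡ-+-* 2 a b)

-- The main reduction: if c ^ M ≤ 2 ^ (n²) and n ≤ M ^ Q, then log₂ c ≤ n² / M ≤ n ^ (2 - 1/Q),
-- which is exactly what AtMostTwoPow c n 1 Q expresses.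
power-bound⇒AtMostTwoPow : ∀ {c n M Q} → 1 ≤ Q → 1 ≤ M →
  c ^ M ≤ 2 ^ (n * n) → n ≤ M ^ Q → AtMostTwoPow c n 1 Q
power-bound⇒AtMostTwoPow {c} {n} {M} {Q} 1≤Q 1≤M c^M≤ n≤M^Q m j _ 2^m<c^j = begin-strict
  m ^ Q * n ^ 1       ≡⟨ cong (m ^ Q *_) (*-identityʳ n) ⟩
  m ^ Q * n           ≤⟨ *-monoʳ-≤ (m ^ Q) n≤M^Q ⟩
  m ^ Q * M ^ Q       ≡⟨ sym (^-distribʳ-* m M Q) ⟩
  (m * M) ^ Q         <⟨ ^-monoˡ-< Q {{>-nonZero 1≤Q}} mM<nnj ⟩
  (n * n * j) ^ Q     ≡⟨ ^-distribʳ-* (n * n) j Q ⟩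
  (n * n) ^ Q * j ^ Q ≡⟨ *-comm ((n * n) ^ Q) (j ^ Q) ⟩
  j ^ Q * (n * n) ^ Q ≡⟨ cong (j ^ Q *_) (trans (cong (_^ Q) (cong (n *_) (sym (*-identityʳ n)))) (^-*-assoc n 2 Q)) ⟩
  j ^ Q * n ^ (2 * Q) ∎
  where
  open ≤-Reasoning
  -- raising 2 ^ m < c ^ j to the M-th power: 2 ^ (m M) < (c ^ M) ^ j ≤ 2 ^ (n² j)
  2^mM<2^nnj : 2 ^ (m * M) < 2 ^ (n * n * j)
  2^mM<2^nnj = begin-strict
    2 ^ (m * M)         ≡⟨ sym (^-*-assoc 2 m M) ⟩
    (2 ^ m) ^ M         <⟨ ^-monoˡ-< M {{>-nonZero 1≤M}} 2^m<c^j ⟩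
    (c ^ j) ^ M         ≡⟨ trans (^-*-assoc c j M) (trans (cong (c ^_) (*-comm j M)) (sym (^-*-assoc c M j))) ⟩
    (c ^ M) ^ j         ≤⟨ ^-monoˡ-≤ j c^M≤ ⟩
    (2 ^ (n * n)) ^ j   ≡⟨ ^-*-assoc 2 (n * n) j ⟩
    2 ^ (n * n * j)     ∎
  mM<nnj : m * M < n * n * j
  mM<nnj = ≰⇒> λ nnj≤mM → <⇒≱ 2^mM<2^nnj (^-monoʳ-≤ 2 nnj≤mM)

locate : (f : ℕ → ℕ) → (∀ r → f r < f (suc r)) → ∀ R n → f R ≤ n →
  Σ ℕ λ r → R ≤ r × f r ≤ n × n < f (suc r)
locate f increasing R zero    fR≤0 = R , ≤-refl , fR≤0 , ≤-<-trans z≤n (increasing R)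
locate f increasing R (suc n) fR≤1+n with f R ≤? n
... | no fR≰n = R , ≤-refl , fR≤1+n , ≤-<-trans (≰⇒> fR≰n) (increasing R)
... | yes fR≤n with locate f increasing R n fR≤n
...   | r , R≤r , fr≤n , n<f[1+r] with suc n <? f (suc r)
...     | yes below = r , R≤r , m≤n⇒m≤1+n fr≤n , below
...     | no  above = suc r , m≤n⇒m≤1+n R≤r , ≮⇒≥ above , ≤-<-trans n<f[1+r] (increasing (suc r))

quadratic≤exp : ∀ x → (7 + x) * suc (2 * (7 + x)) ≤ 2 ^ (7 + x)
quadratic≤exp zero    = toWitness {a? = 105 ≤? 128} tt
quadratic≤exp (suc x) = begin
  (8 + x) * suc (2 * (8 + x))                               ≤⟨ m≤m+n _ (2 * x * x + 25 * x + 74) ⟩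
  (8 + x) * suc (2 * (8 + x)) + (2 * x * x + 25 * x + 74)   ≡⟨ double x ⟩
  2 * ((7 + x) * suc (2 * (7 + x)))                         ≤⟨ *-monoʳ-≤ 2 (quadratic≤exp x) ⟩
  2 * 2 ^ (7 + x)                                           ∎
  where
  open ≤-Reasoning
  double : ∀ x → (8 + x) * suc (2 * (8 + x)) + (2 * x * x + 25 * x + 74) ≡ 2 * ((7 + x) * suc (2 * (7 + x)))
  double = solve-∀

linear≤exp : ∀ a r → 7 + a ≤ r → a * suc (2 * r) ≤ 2 ^ r
linear≤exp a (suc r) 7+a≤1+r with m≤n⇒m<n∨m≡n 7+a≤1+r
... | inj₂ refl = ≤-trans (*-monoˡ-≤ _ (m≤n+m a 7)) (quadratic≤exp a)
... | inj₁ 7+a<1+r = begin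
  a * suc (2 * suc r)                 ≡⟨ step a r ⟩
  a * suc (2 * r) + a * 2             ≤⟨ +-monoʳ-≤ (a * suc (2 * r)) (*-monoʳ-≤ a 2≤1+2r) ⟩
  a * suc (2 * r) + a * suc (2 * r)   ≤⟨ +-mono-≤ IH IH ⟩
  2 ^ r + 2 ^ r                       ≡⟨ cong (2 ^ r +_) (sym (+-identityʳ (2 ^ r))) ⟩
  2 ^ suc r                           ∎
  where
  open ≤-Reasoning
  7+a≤r = s≤s⁻¹ 7+a<1+r
  IH = linear≤exp a r 7+a≤r
  2≤1+2r : 2 ≤ suc (2 * r)
  2≤1+2r = m≤n⇒m≤1+n (*-monoʳ-≤ 2 (≤-trans (s≤s z≤n) 7+a≤r))
  step : ∀ a r → a * suc (2 * suc r) ≡ a * suc (2 * r) + a * 2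
  step = solve-∀

from-offset : ∀ (P : ℕ → Set) {a r} → a ≤ r → (∀ d → P (a + d)) → P r
from-offset P {a} {r} a≤r at-offset = subst P (m+[n∸m]≡n a≤r) (at-offset (r ∸ a))

-- n is located in [2 ^ (scale k * r), 2 ^ (scale k * suc r)).
scale : ℕ → ℕ
scale k = 2 * (k + 2)

-- index tables are affordable once slope k * (2r + 1) ≤ 2 ^ r, which holds beyond the threshold
slope : ℕ → ℕ
slope k = 2 ^ (scale k + 2) * k

-- the least scale used: beyond it r ≥ 7 + slope k and r ≥ k + 2
threshold : ℕ → ℕ
threshold k = 7 + slope k + k

-- The final exponent Q = 1 / ε: the trivial encoding covers n < 2 ^ (E · threshold) ≤ 2 ^ Q,
-- and the block encoding at scale r needs 2 ^ (E (r+1)) ≤ (2 ^ r) ^ Q.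
exponent : ℕ → ℕ
exponent k = 2 * (scale k * threshold k)

scale-pos : ∀ k → 1 ≤ scale k
scale-pos k = ≤-trans (≤-trans (s≤s z≤n) (m≤n+m 2 k)) (m≤m+n (k + 2) _)

exponent-pos : ∀ k → 1 ≤ exponent k
exponent-pos k = ≤-trans (*-mono-≤ (scale-pos k) (s≤s z≤n)) (m≤m+n (scale k * threshold k) _)

-- The block encoding at scale r: blocks of m = 4 ^ r slots, nb = 2 ^ A blocks, and tables of
-- 2 ^ w traces, w = (2r + 1) k bits per index, which is room enough by Sauer–Shelah.  For
-- n ∈ [2 ^ (E r), 2 ^ (E (r+1))) the codes number at most 2 ^ (n² / M) with M = 2 ^ r.
module Scale (k r : ℕ) (beyond : threshold k ≤ r) where
  E M m A nb w : ℕ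
  E  = scale k
  M  = 2 ^ r
  m  = 2 ^ (2 * r)
  A  = E + 2 * r * (k + 1)
  nb = 2 ^ A
  w  = suc (2 * r) * k

  k+2≤r : k + 2 ≤ r
  k+2≤r = ≤-trans (≤-trans (m≤n+m (k + 2) (5 + slope k)) (≤-reflexive (rearrange (slope k) k))) beyond
    where
    rearrange : ∀ s k → 5 + s + (k + 2) ≡ 7 + s + k
    rearrange = solve-∀

  -- below 2 ^ (E (r+1)) = nb * m, every vertex gets a slot
  blocks-cover : ∀ {n} → n < 2 ^ (E * suc r) → n ≤ nb * m
  blocks-cover {n} n< = <⇒≤ (subst (n <_) (trans (cong (2 ^_) (exponents k r)) (sym (pow2-+ A (2 * r)))) n<)
    where
    exponents : ∀ k r → 2 * (k + 2) * suc r ≡ 2 * (k + 2) + 2 * r * (k + 1) + 2 * r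
    exponents = solve-∀

  -- (m + 1) ^ k ≤ (2m) ^ k = 2 ^ w, so the tables hold all outer traces
  sauer-fits : sauerBound m k ≤ 2 ^ w
  sauer-fits = begin
    sauerBound m k       ≤⟨ sauerBound≤ m k ⟩
    suc m ^ k            ≤⟨ ^-monoˡ-≤ k 1+m≤2m ⟩
    (2 ^ suc (2 * r)) ^ k ≡⟨ ^-*-assoc 2 (suc (2 * r)) k ⟩
    2 ^ w                ∎
    where
    open ≤-Reasoning
    1+m≤2m : suc m ≤ 2 * m
    1+m≤2m = ≤-trans (+-monoˡ-≤ m (m^n>0 2 (2 * r))) (≤-reflexive (cong (m +_) (sym (+-identityʳ m))))

  module _ {n : ℕ} (lower : 2 ^ (E * r) ≤ n) where
    F L : ℕ
    F = 2 ^ w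
    -- the code length in bits: tables, indices and own-block traces
    L = m * F * nb + (w * nb * n + m * n)

    -- with F = 2 ^ w all factors of codeCount are powers of two
    codeCount≡ : codeCount n nb m F ≡ 2 ^ L
    codeCount≡ = begin
      ((2 ^ m) ^ F) ^ nb * (((F ^ nb) ^ n) * (2 ^ m) ^ n)
        ≡⟨ cong₂ _*_ (pow-pow m F nb) (cong₂ _*_ (pow-pow w nb n) (^-*-assoc 2 m n)) ⟩
      2 ^ (m * F * nb) * (2 ^ (w * nb * n) * 2 ^ (m * n))
        ≡⟨ trans (cong (2 ^ (m * F * nb) *_) (pow2-+ (w * nb * n) (m * n)))
                 (pow2-+ (m * F * nb) (w * nb * n + m * n)) ⟩
      2 ^ L ∎
      where
      open ≡-Reasoning
      pow-pow : ∀ a b c → ((2 ^ a) ^ b) ^ c ≡ 2 ^ (a * b * c)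
      pow-pow a b c = trans (cong (_^ c) (^-*-assoc 2 a b)) (^-*-assoc 2 (a * b) c)

    -- each of the three parts of the code, times 4M, is at most n²
    tables≤ : m * F * nb * M * 4 ≤ n * n
    tables≤ = begin
      2 ^ (2 * r) * 2 ^ w * 2 ^ A * 2 ^ r * 2 ^ 2
        ≡⟨ trans (cong (λ x → x * 2 ^ A * M * 4) (pow2-+ (2 * r) w))
           (trans (cong (λ x → x * M * 4) (pow2-+ (2 * r + w) A))
           (trans (cong (_* 4) (pow2-+ (2 * r + w + A) r)) (pow2-+ (2 * r + w + A + r) 2))) ⟩
      2 ^ (2 * r + w + A + r + 2) ≤⟨ ^-monoʳ-≤ 2 exponents ⟩
      2 ^ (E * r + E * r)         ≡⟨ sym (pow2-+ (E * r) (E * r)) ⟩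
      2 ^ (E * r) * 2 ^ (E * r)   ≤⟨ *-mono-≤ lower lower ⟩
      n * n                       ∎
      where
      open ≤-Reasoning
      exponents : 2 * r + w + A + r + 2 ≤ E * r + E * r
      exponents = from-offset Exponents k+2≤r λ d → ≤-trans (m≤m+n _ (3 * d)) (≤-reflexive (identity k d))
        where
        Exponents : ℕ → Set
        Exponents r = 2 * r + suc (2 * r) * k + (scale k + 2 * r * (k + 1)) + r + 2 ≤ scale k * r + scale k * r
        identity : ∀ k d → let r = k + 2 + d in
          2 * r + suc (2 * r) * k + (2 * (k + 2) + 2 * r * (k + 1)) + r + 2 + 3 * d ≡ 2 * (k + 2) * r + 2 * (k + 2) * r
        identity = solve-∀

    indices≤ : w * nb * n * M * 4 ≤ n * n
    indices≤ = begin
      w * nb * n * M * 4 ≡⟨ regroup w nb n M ⟩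
      w * nb * M * 4 * n ≤⟨ *-monoˡ-≤ n per-vertex ⟩
      n * n              ∎
      where
      open ≤-Reasoning
      regroup : ∀ a b c d → a * b * c * d * 4 ≡ a * b * d * 4 * c
      regroup = solve-∀
      x y : ℕ
      x = 2 ^ E
      y = 2 ^ (2 * r * (k + 1))
      per-vertex : w * nb * M * 4 ≤ n
      per-vertex = begin
        w * nb * M * 4              ≡⟨ cong (λ b → w * b * M * 4) (sym (pow2-+ E (2 * r * (k + 1)))) ⟩
        w * (x * y) * M * 4         ≡⟨ regroup′ r k x y M ⟩
        x * 4 * k * suc (2 * r) * (y * M)
          ≡⟨ cong (λ s → s * suc (2 * r) * (y * M)) (cong (_* k) (pow2-+ E 2)) ⟩
        slope k * suc (2 * r) * (y * M)
          ≤⟨ *-monoˡ-≤ (y * M) (linear≤exp (slope k) r (≤-trans (m≤m+n (7 + slope k) k) beyond)) ⟩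
        M * (y * M)                 ≡⟨ trans (cong (M *_) (pow2-+ (2 * r * (k + 1)) r)) (pow2-+ r _) ⟩
        2 ^ (r + (2 * r * (k + 1) + r)) ≡⟨ cong (2 ^_) (exponents k r) ⟩
        2 ^ (E * r)                 ≤⟨ lower ⟩
        n                           ∎
        where
        regroup′ : ∀ r k x y z → suc (2 * r) * k * (x * y) * z * 4 ≡ x * 4 * k * suc (2 * r) * (y * z)
        regroup′ = solve-∀
        exponents : ∀ k r → r + (2 * r * (k + 1) + r) ≡ 2 * (k + 2) * r
        exponents = solve-∀

    own≤ : m * n * M * 4 ≤ n * n
    own≤ = begin
      m * n * M * 4              ≡⟨ regroup m n M ⟩
      2 ^ (2 * r) * M * 2 ^ 2 * n ≡⟨ cong (_* n) (trans (cong (_* 4) (pow2-+ (2 * r) r)) (pow2-+ (2 * r + r) 2)) ⟩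
      2 ^ (2 * r + r + 2) * n    ≤⟨ *-monoˡ-≤ n (≤-trans (^-monoʳ-≤ 2 exponents) lower) ⟩
      n * n                      ∎
      where
      open ≤-Reasoning
      regroup : ∀ a b c → a * b * c * 4 ≡ a * c * 4 * b
      regroup = solve-∀
      exponents : 2 * r + r + 2 ≤ E * r
      exponents = from-offset (λ r → 2 * r + r + 2 ≤ scale k * r) k+2≤r λ d →
        ≤-trans (m≤m+n _ (2 * k * (k + 2 + d) + k + d)) (≤-reflexive (identity k d))
        where
        identity : ∀ k d → let r = k + 2 + d in 2 * r + r + 2 + (2 * k * r + k + d) ≡ 2 * (k + 2) * r
        identity = solve-∀

    L*M≤n² : L * M ≤ n * n
    L*M≤n² = *-cancelʳ-≤ (L * M) (n * n) 4 (begin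
      L * M * 4  ≡⟨ distribute (m * F * nb) (w * nb * n) (m * n) M ⟩
      m * F * nb * M * 4 + (w * nb * n * M * 4 + m * n * M * 4) ≤⟨ +-mono-≤ tables≤ (+-mono-≤ indices≤ own≤) ⟩
      n * n + (n * n + n * n) ≤⟨ m≤m+n _ (n * n) ⟩
      n * n + (n * n + n * n) + n * n ≡⟨ four (n * n) ⟩
      n * n * 4 ∎)
      where
      open ≤-Reasoning
      distribute : ∀ a b c e → (a + (b + c)) * e * 4 ≡ a * e * 4 + (b * e * 4 + c * e * 4)
      distribute = solve-∀
      four : ∀ a → a + (a + a) + a ≡ a * 4
      four = solve-∀

    codes-small : codeCount n nb m F ^ M ≤ 2 ^ (n * n)
    codes-small = begin
      codeCount n nb m F ^ M ≡⟨ cong (_^ M) codeCount≡ ⟩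
      (2 ^ L) ^ M            ≡⟨ ^-*-assoc 2 L M ⟩
      2 ^ (L * M)            ≤⟨ ^-monoʳ-≤ 2 L*M≤n² ⟩
      2 ^ (n * n)            ∎
      where open ≤-Reasoning

  below-next-scale : ∀ {n} → n < 2 ^ (E * suc r) → n ≤ M ^ exponent k
  below-next-scale {n} upper =
    ≤-trans (<⇒≤ upper) (subst (2 ^ (E * suc r) ≤_) (sym (^-*-assoc 2 r (exponent k))) (^-monoʳ-≤ 2 (begin
      E * suc r                                 ≡⟨ *-suc E r ⟩
      E + E * r                                 ≤⟨ +-monoˡ-≤ (E * r) (m≤m*n E r {{>-nonZero r-pos}}) ⟩
      E * r + E * r                             ≤⟨ +-mono-≤ (m≤m*n (E * r) (threshold k)) (m≤m*n (E * r) (threshold k)) ⟩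
      E * r * threshold k + E * r * threshold k ≡⟨ regroup E r (threshold k) ⟩
      r * exponent k                            ∎)))
    where
    open ≤-Reasoning
    r-pos : 1 ≤ r
    r-pos = ≤-trans (s≤s z≤n) beyond
    regroup : ∀ e r t → e * r * t + e * r * t ≡ r * (2 * (e * t))
    regroup = solve-∀

  scale-bound : ∀ {n c} → 2 ^ (E * r) ≤ n → n < 2 ^ (E * suc r) → (G : Fin c → Graph n) →
    (∀ i → UFree k (G i)) → Distinct G → c ^ M ≤ 2 ^ (n * n)
  scale-bound {n} {c} lower upper G free distinct = ≤-trans (^-monoˡ-≤ M c≤) (codes-small lower)
    where
    c≤ : c ≤ codeCount n nb m (2 ^ w)
    c≤ = Blocks.distinct-free≤codeCount {n} {nb} {m} (blocks-cover upper) sauer-fits (m^n>0 2 w) G free distinct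

trivial-bound : ∀ {n c} (G : Fin c → Graph n) → Distinct G → c ^ 2 ≤ 2 ^ (n * n)
trivial-bound {n} {c} G distinct =
  ≤-trans (*-mono-≤ c≤ (≤-trans (≤-reflexive (*-identityʳ c)) c≤)) (triangleCount² n)
  where
  c≤ : c ≤ triangleCount n
  c≤ = distinct≤codes (triangle↔ n) fromTriangle G (λ i → toTriangle (G i)) distinct

-- A distinct family of c U(k)-free graphs on [n] satisfies c ^ M ≤ 2 ^ (n²) for some M ≥ 1 with
-- n ≤ M ^ exponent k: below the threshold by the trivial encoding (M = 2), above it by the block
-- encoding at the scale r with n ∈ [2 ^ (E r), 2 ^ (E (r+1))) (M = 2 ^ r).
free-family-bound : ∀ k n c (G : Fin c → Graph n) → (∀ i → UFree k (G i)) → Distinct G →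
  Σ ℕ λ M → 1 ≤ M × c ^ M ≤ 2 ^ (n * n) × n ≤ M ^ exponent k
free-family-bound k n c G free distinct with 2 ^ (scale k * threshold k) ≤? n
... | no small =
  2 , s≤s z≤n , trivial-bound G distinct ,
  ≤-trans (<⇒≤ (≰⇒> small)) (^-monoʳ-≤ 2 (m≤m+n (scale k * threshold k) _))
... | yes large with locate (λ r → 2 ^ (scale k * r)) increasing (threshold k) n large
  where
  increasing : ∀ r → 2 ^ (scale k * r) < 2 ^ (scale k * suc r)
  increasing r = ^-monoʳ-< 2 (s≤s (s≤s z≤n)) (*-monoʳ-< (scale k) {{>-nonZero (scale-pos k)}} (n<1+n r))
... | r , beyond , lower , upper =
  M , m^n>0 2 r , scale-bound lower upper G free distinct , below-next-scale upper
  where open Scale k r beyond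

theorem2 : (k : ℕ) →
    Σ ℕ λ p → Σ ℕ λ q → 1 ≤ p × 1 ≤ q ×
      ((n c : ℕ) (G : Fin c → Graph n) →
        (∀ i → UFree k (G i)) →
        (∀ i i' → SameGraph (G i) (G i') → i ≡ i') →
        AtMostTwoPow c n p q)
theorem2 k = 1 , exponent k , ≤-refl , exponent-pos k , λ n c G free distinct →
  let M , 1≤M , c^M≤2^n² , n≤M^Q = free-family-bound k n c G free distinct
  in power-bound⇒AtMostTwoPow (exponent-pos k) 1≤M c^M≤2^n² n≤M^Q
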